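{- Let $O=(0,0)$ and $P=(a,b)\in\mathbb{Z}^2$ with $P\neq O$. The set $$\mathcal{S}_2(\mathbb{Z}[i])=\{Q=(x,y)\in(\mathbb{Z}[i])^2:\ x^2+y^2 \text{ and } (x-a)^2+(y-b)^2 \text{ are both squares in } \mathbb{Z}[i]\}$$ is Zariski-dense in the plane $\mathbb{A}^2$.
   Context: Here "distance" is taken algebraically: for points with coordinates in $\mathbb{Z}[i]$, the distance between $A$ and $B$ is a square root of the sum of the squares of the coordinates of $\overrightarrow{AB}$, and it is required to lie in $\mathbb{Z}[i]$ (the sign is immaterial). -}

module Defs where

open import Data.Integer as ℤ using (ℤ; +_)
open import Data.List using (List; []; _∷_)
open import Data.List.Relation.Unary.Any using (Any)
open import Data.Product using (∃; _×_)
open import Relation.Binary.PropositionalEquality using (_≡_)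
open import Relation.Nullary using (¬_)

record ℤ[i] : Set where
  constructor _+_i
  field
    re : ℤ
    im : ℤ
open ℤ[i] public

infixl 6 _+ᵍ_ _-ᵍ_
infixl 7 _*ᵍ_

_+ᵍ_ : ℤ[i] → ℤ[i] → ℤ[i]
(a + b i) +ᵍ (c + d i) = (a ℤ.+ c) + (b ℤ.+ d) i

-ᵍ_ : ℤ[i] → ℤ[i]
-ᵍ (a + b i) = (ℤ.- a) + (ℤ.- b) i

_-ᵍ_ : ℤ[i] → ℤ[i] → ℤ[i]
z -ᵍ w = z +ᵍ (-ᵍ w)

_*ᵍ_ : ℤ[i] → ℤ[i] → ℤ[i]
(a + b i) *ᵍ (c + d i) = (a ℤ.* c ℤ.- b ℤ.* d) + (a ℤ.* d ℤ.+ b ℤ.* c) i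

0ᵍ : ℤ[i]
0ᵍ = (+ 0) + (+ 0) i

ι : ℤ → ℤ[i]
ι a = a + (+ 0) i

IsSquare : ℤ[i] → Set
IsSquare w = ∃ λ z → z *ᵍ z ≡ w

InS₂ : ℤ → ℤ → ℤ[i] → ℤ[i] → Set
InS₂ a b x y =
  IsSquare (x *ᵍ x +ᵍ y *ᵍ y) ×
  IsSquare ((x -ᵍ ι a) *ᵍ (x -ᵍ ι a) +ᵍ (y -ᵍ ι b) *ᵍ (y -ᵍ ι b))

-- Polynomials in ℤ[i][X,Y] as dense coefficient lists:
-- a one-variable polynomial c₀ ∷ c₁ ∷ … denotes Σ cₖ Yᵏ,
-- a two-variable polynomial p₀ ∷ p₁ ∷ … denotes Σ pⱼ(Y) Xʲ.
Poly₁ : Set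
Poly₁ = List ℤ[i]

Poly₂ : Set
Poly₂ = List Poly₁

eval₁ : Poly₁ → ℤ[i] → ℤ[i]
eval₁ []       y = 0ᵍ
eval₁ (c ∷ cs) y = c +ᵍ y *ᵍ eval₁ cs y

eval₂ : Poly₂ → ℤ[i] → ℤ[i] → ℤ[i]
eval₂ []       x y = 0ᵍ
eval₂ (p ∷ ps) x y = eval₁ p y +ᵍ x *ᵍ eval₂ ps x y

NonZeroPoly : Poly₂ → Set
NonZeroPoly f = Any (Any (λ c → ¬ (c ≡ 0ᵍ))) f

ZariskiDense : (ℤ[i] → ℤ[i] → Set) → Set
ZariskiDense S = ∀ (f : Poly₂) → NonZeroPoly f →
  ∃ λ x → ∃ λ y → S x y × ¬ (eval₂ f x y ≡ 0ᵍ)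

-- With c = a + ib, c′ = a − ib and the coordinates u = x + iy, v = x − iy, the two conditions
-- say that uv and (u − c)(v − c′) are squares.  Both hold when u = c s², v = c s′² with
-- c s² − c = δ t² and c s′² − c′ = δ t′² for a common δ.  For δ = cσ² − c′ the pairs (1, 0) and
-- (σ, 1) represent c and c′ by the form c s² − δ t², and so do their orbits under the
-- automorphism (s, t) ↦ (ps + δmt, cms + pt) attached to a solution of p² − cδm² = 1, which
-- 2σ = c′m and p = cσm − 1 provide.  The first coordinates obey s₍ₙ₊₂₎ = 2p s₍ₙ₊₁₎ − sₙ and grow
-- in norm, so the points obtained have v of arbitrarily large norm and, for each such v, u as
-- well; a nonzero polynomial cannot vanish on all of them.  Choosing σ and m according to the
-- parities of a and b keeps (u − v)/2 integral.

module Submission where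

open import Defs
open import Algebra.Bundles using (CommutativeRing)
open import Data.Integer as ℤ using (ℤ; +_; +0; +[1+_]; -[1+_])
open import Data.Integer.DivMod using (a≡a%ℕn+[a/ℕn]*n; n%ℕd<d)
import Data.Integer.Properties as ℤ
import Data.Integer.Tactic.RingSolver as ℤSolver
open import Data.List using ([]; _∷_; map)
open import Data.List.Relation.Unary.Any using (Any; here; there; any?)
open import Data.Maybe using (Maybe; just; nothing)
open import Data.Nat using (ℕ; zero; suc; _+_; _*_; _⊔_; _≤_; _<_; z≤n; s≤s; >-nonZero)
open import Data.Nat.Properties
  using ( ≤-trans; <-≤-trans; ≤-<-trans; <⇒≤; <⇒≱; ≤ᵇ⇒≤; m≤m+n; m≤m*n; m⊔n<o⇒m<o; m⊔n<o⇒n<o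
        ; +-monoʳ-≤; *-mono-≤; *-monoˡ-≤; *-monoʳ-≤; *-monoˡ-<; *-assoc; *-distribʳ-+
        ; +-cancelʳ-≤; +-cancelʳ-<; *-cancelˡ-≤; *-cancelˡ-<; module ≤-Reasoning )
open import Data.Product using (∃; ∃₂; _×_; _,_; proj₁; proj₂)
open import Data.Sum as Sum using (_⊎_; inj₁; inj₂)
open import Data.Unit using (⊤; tt)
open import Function using (_∘_)
open import Level using (0ℓ)
open import Relation.Binary.Definitions using (DecidableEquality)
open import Relation.Binary.PropositionalEquality
open import Relation.Nullary using (¬_; ¬?; yes; no; contradiction)
open import Relation.Nullary.Decidable using (decidable-stable)
open import Tactic.RingSolver using (solve; solve-∀)
open import Tactic.RingSolver.Core.AlmostCommutativeRing
  using (AlmostCommutativeRing; fromCommutativeRing)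

open import Algebra.Structures {A = ℤ[i]} _≡_ using (IsCommutativeRing)

1ᵍ 2ᵍ iᵍ : ℤ[i]
1ᵍ = ι (+ 1)
2ᵍ = ι (+ 2)
iᵍ = (+ 0) + (+ 1) i

ℤ[i]-ext : ∀ {x y} → re x ≡ re y → im x ≡ im y → x ≡ y
ℤ[i]-ext = cong₂ _+_i

_≟ᵍ_ : DecidableEquality ℤ[i]
(a + b i) ≟ᵍ (c + d i) with a ℤ.≟ c | b ℤ.≟ d
... | yes refl | yes refl = yes refl
... | no a≢c   | _        = no λ { refl → a≢c refl }
... | yes _    | no b≢d   = no λ { refl → b≢d refl }

ℤ[i]-isCommutativeRing : IsCommutativeRing _+ᵍ_ _*ᵍ_ -ᵍ_ 0ᵍ 1ᵍ
ℤ[i]-isCommutativeRing = record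
  { isRing = record
    { +-isAbelianGroup = record
      { isGroup = record
        { isMonoid = record
          { isSemigroup = record
            { isMagma = record { isEquivalence = isEquivalence ; ∙-cong = cong₂ _+ᵍ_ }
            ; assoc = λ x y z → ℤ[i]-ext (ℤ.+-assoc (re x) (re y) (re z)) (ℤ.+-assoc (im x) (im y) (im z))
            }
          ; identity = (λ x → ℤ[i]-ext (ℤ.+-identityˡ (re x)) (ℤ.+-identityˡ (im x)))
                     , (λ x → ℤ[i]-ext (ℤ.+-identityʳ (re x)) (ℤ.+-identityʳ (im x)))
          }
        ; inverse = (λ x → ℤ[i]-ext (ℤ.+-inverseˡ (re x)) (ℤ.+-inverseˡ (im x)))
                  , (λ x → ℤ[i]-ext (ℤ.+-inverseʳ (re x)) (ℤ.+-inverseʳ (im x)))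
        ; ⁻¹-cong = cong (-ᵍ_)
        }
      ; comm = λ x y → ℤ[i]-ext (ℤ.+-comm (re x) (re y)) (ℤ.+-comm (im x) (im y))
      }
    ; *-cong = cong₂ _*ᵍ_
    ; *-assoc = λ (a + b i) (c + d i) (e + f i) →
        ℤ[i]-ext (*-assocᵣ a b c d e f) (*-assocᵢ a b c d e f)
    ; *-identity = (λ (a + b i) → ℤ[i]-ext (*-identityˡᵣ a b) (*-identityˡᵢ a b))
                 , (λ (a + b i) → ℤ[i]-ext (*-identityʳᵣ a b) (*-identityʳᵢ a b))
    ; distrib = (λ (a + b i) (c + d i) (e + f i) →
                  ℤ[i]-ext (distribˡᵣ a b c d e f) (distribˡᵢ a b c d e f))
              , (λ (a + b i) (c + d i) (e + f i) →
                  ℤ[i]-ext (distribʳᵣ a b c d e f) (distribʳᵢ a b c d e f))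
    }
  ; *-comm = λ (a + b i) (c + d i) → ℤ[i]-ext (*-commᵣ a b c d) (*-commᵢ a b c d)
  }
  where
  *-assocᵣ : ∀ a b c d e f → (a ℤ.* c ℤ.- b ℤ.* d) ℤ.* e ℤ.- (a ℤ.* d ℤ.+ b ℤ.* c) ℤ.* f
                           ≡ a ℤ.* (c ℤ.* e ℤ.- d ℤ.* f) ℤ.- b ℤ.* (c ℤ.* f ℤ.+ d ℤ.* e)
  *-assocᵣ = ℤSolver.solve-∀
  *-assocᵢ : ∀ a b c d e f → (a ℤ.* c ℤ.- b ℤ.* d) ℤ.* f ℤ.+ (a ℤ.* d ℤ.+ b ℤ.* c) ℤ.* e
                           ≡ a ℤ.* (c ℤ.* f ℤ.+ d ℤ.* e) ℤ.+ b ℤ.* (c ℤ.* e ℤ.- d ℤ.* f)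
  *-assocᵢ = ℤSolver.solve-∀
  *-identityˡᵣ : ∀ a b → + 1 ℤ.* a ℤ.- + 0 ℤ.* b ≡ a
  *-identityˡᵣ = ℤSolver.solve-∀
  *-identityˡᵢ : ∀ a b → + 1 ℤ.* b ℤ.+ + 0 ℤ.* a ≡ b
  *-identityˡᵢ = ℤSolver.solve-∀
  *-identityʳᵣ : ∀ a b → a ℤ.* + 1 ℤ.- b ℤ.* + 0 ≡ a
  *-identityʳᵣ = ℤSolver.solve-∀
  *-identityʳᵢ : ∀ a b → a ℤ.* + 0 ℤ.+ b ℤ.* + 1 ≡ b
  *-identityʳᵢ = ℤSolver.solve-∀
  distribˡᵣ : ∀ a b c d e f → a ℤ.* (c ℤ.+ e) ℤ.- b ℤ.* (d ℤ.+ f)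
                            ≡ (a ℤ.* c ℤ.- b ℤ.* d) ℤ.+ (a ℤ.* e ℤ.- b ℤ.* f)
  distribˡᵣ = ℤSolver.solve-∀
  distribˡᵢ : ∀ a b c d e f → a ℤ.* (d ℤ.+ f) ℤ.+ b ℤ.* (c ℤ.+ e)
                            ≡ (a ℤ.* d ℤ.+ b ℤ.* c) ℤ.+ (a ℤ.* f ℤ.+ b ℤ.* e)
  distribˡᵢ = ℤSolver.solve-∀
  distribʳᵣ : ∀ a b c d e f → (c ℤ.+ e) ℤ.* a ℤ.- (d ℤ.+ f) ℤ.* b
                            ≡ (c ℤ.* a ℤ.- d ℤ.* b) ℤ.+ (e ℤ.* a ℤ.- f ℤ.* b)
  distribʳᵣ = ℤSolver.solve-∀
  distribʳᵢ : ∀ a b c d e f → (c ℤ.+ e) ℤ.* b ℤ.+ (d ℤ.+ f) ℤ.* a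
                            ≡ (c ℤ.* b ℤ.+ d ℤ.* a) ℤ.+ (e ℤ.* b ℤ.+ f ℤ.* a)
  distribʳᵢ = ℤSolver.solve-∀
  *-commᵣ : ∀ a b c d → a ℤ.* c ℤ.- b ℤ.* d ≡ c ℤ.* a ℤ.- d ℤ.* b
  *-commᵣ = ℤSolver.solve-∀
  *-commᵢ : ∀ a b c d → a ℤ.* d ℤ.+ b ℤ.* c ≡ c ℤ.* b ℤ.+ d ℤ.* a
  *-commᵢ = ℤSolver.solve-∀

ℤ[i]-commutativeRing : CommutativeRing 0ℓ 0ℓ
ℤ[i]-commutativeRing = record { isCommutativeRing = ℤ[i]-isCommutativeRing }

ℤ[i]-ring : AlmostCommutativeRing 0ℓ 0ℓ
ℤ[i]-ring = fromCommutativeRing ℤ[i]-commutativeRing is-zero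
  where
  is-zero : ∀ x → Maybe (0ᵍ ≡ x)
  is-zero x with 0ᵍ ≟ᵍ x
  ... | yes 0≡x = just 0≡x
  ... | no _    = nothing

x-y≡z⇒x-z≡y : ∀ x y {z} → x -ᵍ y ≡ z → x -ᵍ z ≡ y
x-y≡z⇒x-z≡y x y refl = solve (x ∷ y ∷ []) ℤ[i]-ring

x+y≡0⇒x≡-y : ∀ x y → x +ᵍ y ≡ 0ᵍ → x ≡ -ᵍ y
x+y≡0⇒x≡-y x y x+y≡0 = begin
  x                   ≡⟨ solve (x ∷ y ∷ []) ℤ[i]-ring ⟩
  (x +ᵍ y) -ᵍ y       ≡⟨ cong (_-ᵍ y) x+y≡0 ⟩
  0ᵍ -ᵍ y             ≡⟨ solve (y ∷ []) ℤ[i]-ring ⟩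
  -ᵍ y                ∎
  where open ≡-Reasoning

-- The norm

‖_‖ : ℤ[i] → ℕ
‖ z ‖ = ℤ.∣ re z ∣ * ℤ.∣ re z ∣ + ℤ.∣ im z ∣ * ℤ.∣ im z ∣

+‖z‖≡re²+im² : ∀ z → + ‖ z ‖ ≡ re z ℤ.* re z ℤ.+ im z ℤ.* im z
+‖z‖≡re²+im² z = trans (ℤ.pos-+ (ℤ.∣ re z ∣ * ℤ.∣ re z ∣) (ℤ.∣ im z ∣ * ℤ.∣ im z ∣))
                   (cong₂ ℤ._+_ (+∣a∣²≡a² (re z)) (+∣a∣²≡a² (im z)))
  where
  +∣a∣²≡a² : ∀ a → + (ℤ.∣ a ∣ * ℤ.∣ a ∣) ≡ a ℤ.* a
  +∣a∣²≡a² (+ n)    = ℤ.pos-* n n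
  +∣a∣²≡a² -[1+ n ] = refl

‖x*y‖≡‖x‖*‖y‖ : ∀ x y → ‖ x *ᵍ y ‖ ≡ ‖ x ‖ * ‖ y ‖
‖x*y‖≡‖x‖*‖y‖ x@(a + b i) y@(c + d i) = ℤ.+-injective (begin
  + ‖ x *ᵍ y ‖
    ≡⟨ +‖z‖≡re²+im² (x *ᵍ y) ⟩
  (a ℤ.* c ℤ.- b ℤ.* d) ℤ.* (a ℤ.* c ℤ.- b ℤ.* d) ℤ.+ (a ℤ.* d ℤ.+ b ℤ.* c) ℤ.* (a ℤ.* d ℤ.+ b ℤ.* c)
    ≡⟨ ℤSolver.solve (a ∷ b ∷ c ∷ d ∷ []) ⟩
  (a ℤ.* a ℤ.+ b ℤ.* b) ℤ.* (c ℤ.* c ℤ.+ d ℤ.* d)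
    ≡⟨ cong₂ ℤ._*_ (+‖z‖≡re²+im² x) (+‖z‖≡re²+im² y) ⟨
  + ‖ x ‖ ℤ.* + ‖ y ‖
    ≡⟨ ℤ.pos-* ‖ x ‖ ‖ y ‖ ⟨
  + (‖ x ‖ * ‖ y ‖) ∎)
  where open ≡-Reasoning

‖x+y‖+‖x-y‖≡2‖x‖+2‖y‖ : ∀ x y → ‖ x +ᵍ y ‖ + ‖ x -ᵍ y ‖ ≡ 2 * ‖ x ‖ + 2 * ‖ y ‖
‖x+y‖+‖x-y‖≡2‖x‖+2‖y‖ x@(a + b i) y@(c + d i) = ℤ.+-injective (begin
  + (‖ x +ᵍ y ‖ + ‖ x -ᵍ y ‖)
    ≡⟨ ℤ.pos-+ ‖ x +ᵍ y ‖ ‖ x -ᵍ y ‖ ⟩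
  + ‖ x +ᵍ y ‖ ℤ.+ + ‖ x -ᵍ y ‖
    ≡⟨ cong₂ ℤ._+_ (+‖z‖≡re²+im² (x +ᵍ y)) (+‖z‖≡re²+im² (x -ᵍ y)) ⟩
  ((a ℤ.+ c) ℤ.* (a ℤ.+ c) ℤ.+ (b ℤ.+ d) ℤ.* (b ℤ.+ d))
    ℤ.+ ((a ℤ.- c) ℤ.* (a ℤ.- c) ℤ.+ (b ℤ.- d) ℤ.* (b ℤ.- d))
    ≡⟨ ℤSolver.solve (a ∷ b ∷ c ∷ d ∷ []) ⟩
  + 2 ℤ.* (a ℤ.* a ℤ.+ b ℤ.* b) ℤ.+ + 2 ℤ.* (c ℤ.* c ℤ.+ d ℤ.* d)
    ≡⟨ cong₂ (λ m n → + 2 ℤ.* m ℤ.+ + 2 ℤ.* n) (+‖z‖≡re²+im² x) (+‖z‖≡re²+im² y) ⟨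
  + 2 ℤ.* + ‖ x ‖ ℤ.+ + 2 ℤ.* + ‖ y ‖
    ≡⟨ cong₂ ℤ._+_ (ℤ.pos-* 2 ‖ x ‖) (ℤ.pos-* 2 ‖ y ‖) ⟨
  + (2 * ‖ x ‖) ℤ.+ + (2 * ‖ y ‖)
    ≡⟨ ℤ.pos-+ (2 * ‖ x ‖) (2 * ‖ y ‖) ⟨
  + (2 * ‖ x ‖ + 2 * ‖ y ‖) ∎)
  where open ≡-Reasoning

‖x+x‖≡4*‖x‖ : ∀ x → ‖ x +ᵍ x ‖ ≡ 4 * ‖ x ‖
‖x+x‖≡4*‖x‖ x = trans (cong ‖_‖ (x+x≡2x x)) (‖x*y‖≡‖x‖*‖y‖ 2ᵍ x)
  where
  x+x≡2x : ∀ x → x +ᵍ x ≡ 2ᵍ *ᵍ x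
  x+x≡2x = solve-∀ ℤ[i]-ring

‖-x‖≡‖x‖ : ∀ x → ‖ -ᵍ x ‖ ≡ ‖ x ‖
‖-x‖≡‖x‖ x rewrite ℤ.∣-i∣≡∣i∣ (re x) | ℤ.∣-i∣≡∣i∣ (im x) = refl

x≢0⇒‖x‖>0 : ∀ {x} → x ≢ 0ᵍ → 0 < ‖ x ‖
x≢0⇒‖x‖>0 {+0 + +0 i}            x≢0 = contradiction refl x≢0
x≢0⇒‖x‖>0 {+[1+ _ ] + _ i}       _   = s≤s z≤n
x≢0⇒‖x‖>0 { -[1+ _ ] + _ i}      _   = s≤s z≤n
x≢0⇒‖x‖>0 {+0 + +[1+ _ ] i}      _   = s≤s z≤n
x≢0⇒‖x‖>0 {+0 + -[1+ _ ] i}      _   = s≤s z≤n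

‖x‖>0⇒x≢0 : ∀ {x} → 0 < ‖ x ‖ → x ≢ 0ᵍ
‖x‖>0⇒x≢0 () refl

‖x‖≤‖x*y‖ : ∀ x {y} → y ≢ 0ᵍ → ‖ x ‖ ≤ ‖ x *ᵍ y ‖
‖x‖≤‖x*y‖ x {y} y≢0 = begin
  ‖ x ‖         ≤⟨ m≤m*n ‖ x ‖ ‖ y ‖ {{>-nonZero (x≢0⇒‖x‖>0 y≢0)}} ⟩
  ‖ x ‖ * ‖ y ‖ ≡⟨ ‖x*y‖≡‖x‖*‖y‖ x y ⟨
  ‖ x *ᵍ y ‖    ∎
  where open ≤-Reasoning

‖x‖≤2‖x-y‖+2‖y‖ : ∀ x y → ‖ x ‖ ≤ 2 * ‖ x -ᵍ y ‖ + 2 * ‖ y ‖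
‖x‖≤2‖x-y‖+2‖y‖ x y = begin
  ‖ x ‖                             ≡⟨ cong ‖_‖ (x≡x-y+y x y) ⟩
  ‖ (x -ᵍ y) +ᵍ y ‖                 ≤⟨ m≤m+n _ _ ⟩
  ‖ (x -ᵍ y) +ᵍ y ‖ + ‖ (x -ᵍ y) -ᵍ y ‖ ≡⟨ ‖x+y‖+‖x-y‖≡2‖x‖+2‖y‖ (x -ᵍ y) y ⟩
  2 * ‖ x -ᵍ y ‖ + 2 * ‖ y ‖        ∎
  where
  open ≤-Reasoning
  x≡x-y+y : ∀ x y → x ≡ (x -ᵍ y) +ᵍ y
  x≡x-y+y = solve-∀ ℤ[i]-ring

16≤‖z‖⇒4≤‖z-1‖ : ∀ z → 16 ≤ ‖ z ‖ → 4 ≤ ‖ z -ᵍ 1ᵍ ‖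
16≤‖z‖⇒4≤‖z-1‖ z 16≤‖z‖ = *-cancelˡ-≤ 2 (+-cancelʳ-≤ 2 (2 * 4) (2 * ‖ z -ᵍ 1ᵍ ‖) (begin
  2 * 4 + 2                ≤⟨ ≤ᵇ⇒≤ 10 16 _ ⟩
  16                       ≤⟨ 16≤‖z‖ ⟩
  ‖ z ‖                    ≤⟨ ‖x‖≤2‖x-y‖+2‖y‖ z 1ᵍ ⟩
  2 * ‖ z -ᵍ 1ᵍ ‖ + 2      ∎))
  where open ≤-Reasoning

‖s‖≤‖c*s²‖ : ∀ {c} s → c ≢ 0ᵍ → ‖ s ‖ ≤ ‖ c *ᵍ (s *ᵍ s) ‖
‖s‖≤‖c*s²‖ {c} s c≢0 with s ≟ᵍ 0ᵍ
... | yes refl = z≤n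
... | no  s≢0  = begin
  ‖ s ‖                ≤⟨ ‖x‖≤‖x*y‖ s s≢0 ⟩
  ‖ s *ᵍ s ‖           ≤⟨ ‖x‖≤‖x*y‖ (s *ᵍ s) c≢0 ⟩
  ‖ (s *ᵍ s) *ᵍ c ‖    ≡⟨ cong ‖_‖ (IsCommutativeRing.*-comm ℤ[i]-isCommutativeRing (s *ᵍ s) c) ⟩
  ‖ c *ᵍ (s *ᵍ s) ‖    ∎
  where open ≤-Reasoning

‖s‖<‖2ps-r‖ : ∀ p s r → 4 ≤ ‖ p ‖ → 0 < ‖ s ‖ → ‖ r ‖ ≤ ‖ s ‖ → ‖ s ‖ < ‖ (p +ᵍ p) *ᵍ s -ᵍ r ‖
‖s‖<‖2ps-r‖ p s r 4≤‖p‖ ‖s‖>0 ‖r‖≤‖s‖ =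
  *-cancelˡ-< 2 ‖ s ‖ ‖ x -ᵍ r ‖ (+-cancelʳ-< (2 * ‖ s ‖) (2 * ‖ s ‖) (2 * ‖ x -ᵍ r ‖) (begin-strict
    2 * ‖ s ‖ + 2 * ‖ s ‖        ≡⟨ *-distribʳ-+ ‖ s ‖ 2 2 ⟨
    4 * ‖ s ‖                    <⟨ *-monoˡ-< ‖ s ‖ {{>-nonZero ‖s‖>0}} (≤ᵇ⇒≤ 5 16 _) ⟩
    16 * ‖ s ‖                   ≤⟨ *-monoˡ-≤ ‖ s ‖ (*-monoʳ-≤ 4 4≤‖p‖) ⟩
    4 * ‖ p ‖ * ‖ s ‖            ≡⟨ cong (_* ‖ s ‖) (‖x+x‖≡4*‖x‖ p) ⟨
    ‖ p +ᵍ p ‖ * ‖ s ‖           ≡⟨ ‖x*y‖≡‖x‖*‖y‖ (p +ᵍ p) s ⟨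
    ‖ x ‖                        ≤⟨ ‖x‖≤2‖x-y‖+2‖y‖ x r ⟩
    2 * ‖ x -ᵍ r ‖ + 2 * ‖ r ‖   ≤⟨ +-monoʳ-≤ (2 * ‖ x -ᵍ r ‖) (*-monoʳ-≤ 2 ‖r‖≤‖s‖) ⟩
    2 * ‖ x -ᵍ r ‖ + 2 * ‖ s ‖   ∎))
  where
  open ≤-Reasoning
  x = (p +ᵍ p) *ᵍ s

‖s[1+n]‖>n : ∀ (s : ℕ → ℤ[i]) p → 4 ≤ ‖ p ‖ →
  (∀ n → s (suc (suc n)) ≡ (p +ᵍ p) *ᵍ s (suc n) -ᵍ s n) →
  0 < ‖ s 0 ‖ → ‖ s 0 ‖ ≤ ‖ s 1 ‖ → ∀ n → n < ‖ s (suc n) ‖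
‖s[1+n]‖>n s p 4≤‖p‖ s-rec ‖s₀‖>0 ‖s₀‖≤‖s₁‖ = proj₂ ∘ invariant
  where
  invariant : ∀ n → ‖ s n ‖ ≤ ‖ s (suc n) ‖ × n < ‖ s (suc n) ‖
  invariant zero    = ‖s₀‖≤‖s₁‖ , <-≤-trans ‖s₀‖>0 ‖s₀‖≤‖s₁‖
  invariant (suc n) with invariant n
  ... | ‖sₙ‖≤‖sₙ₊₁‖ , n<‖sₙ₊₁‖ = <⇒≤ ‖sₙ₊₁‖<‖sₙ₊₂‖ , ≤-<-trans n<‖sₙ₊₁‖ ‖sₙ₊₁‖<‖sₙ₊₂‖
    where
    ‖sₙ₊₁‖<‖sₙ₊₂‖ : ‖ s (suc n) ‖ < ‖ s (suc (suc n)) ‖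
    ‖sₙ₊₁‖<‖sₙ₊₂‖ = subst (λ w → ‖ s (suc n) ‖ < ‖ w ‖) (sym (s-rec n))
                      (‖s‖<‖2ps-r‖ p (s (suc n)) (s n) 4≤‖p‖ (≤-<-trans z≤n n<‖sₙ₊₁‖) ‖sₙ‖≤‖sₙ₊₁‖)

half-difference-large : ∀ u v h K → u -ᵍ v ≡ 2ᵍ *ᵍ h → 8 * K + 2 * ‖ v ‖ < ‖ u ‖ → K < ‖ h ‖
half-difference-large u v h K u-v≡2h 8K+2‖v‖<‖u‖ =
  *-cancelˡ-< 8 K ‖ h ‖ (+-cancelʳ-< (2 * ‖ v ‖) (8 * K) (8 * ‖ h ‖) (begin-strict
    8 * K + 2 * ‖ v ‖              <⟨ 8K+2‖v‖<‖u‖ ⟩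
    ‖ u ‖                          ≤⟨ ‖x‖≤2‖x-y‖+2‖y‖ u v ⟩
    2 * ‖ u -ᵍ v ‖ + 2 * ‖ v ‖     ≡⟨ cong (λ w → 2 * ‖ w ‖ + 2 * ‖ v ‖) u-v≡2h ⟩
    2 * ‖ 2ᵍ *ᵍ h ‖ + 2 * ‖ v ‖    ≡⟨ cong (λ n → 2 * n + 2 * ‖ v ‖) (‖x*y‖≡‖x‖*‖y‖ 2ᵍ h) ⟩
    2 * (4 * ‖ h ‖) + 2 * ‖ v ‖    ≡⟨ cong (_+ 2 * ‖ v ‖) (*-assoc 2 4 ‖ h ‖) ⟨
    8 * ‖ h ‖ + 2 * ‖ v ‖          ∎))
  where open ≤-Reasoning

-- Polynomials: nonvanishing at points of large norm, linear substitutions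

NonZero₁ : Poly₁ → Set
NonZero₁ = Any (_≢ 0ᵍ)

Eventually : (ℤ[i] → Set) → Set
Eventually P = ∃ λ K → ∀ z → K < ‖ z ‖ → P z

Unbounded : (ℤ[i] → Set) → Set
Unbounded P = ∀ K → ∃ λ z → K < ‖ z ‖ × P z

module _ {P Q : ℤ[i] → Set} where

  Eventually-map : (∀ {z} → P z → Q z) → Eventually P → Eventually Q
  Eventually-map P⇒Q (K , P-large) = K , λ z K<‖z‖ → P⇒Q (P-large z K<‖z‖)

  Unbounded-map : (∀ {z} → P z → Q z) → Unbounded P → Unbounded Q
  Unbounded-map P⇒Q P-unbounded K =
    let (z , K<‖z‖ , Pz) = P-unbounded K in z , K<‖z‖ , P⇒Q Pz

  Eventually∧Unbounded⇒∃ : Eventually P → Unbounded Q → ∃ λ z → P z × Q z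
  Eventually∧Unbounded⇒∃ (K , P-large) Q-unbounded =
    let (z , K<‖z‖ , Qz) = Q-unbounded K in z , P-large z K<‖z‖ , Qz

Unbounded-⊤ : Unbounded (λ _ → ⊤)
Unbounded-⊤ K = ι (+ suc K) , ≤-trans (m≤m*n (suc K) (suc K)) (m≤m+n _ 0) , tt

‖root‖≤‖c‖ : ∀ c z {e} → c +ᵍ z *ᵍ e ≡ 0ᵍ → e ≢ 0ᵍ → ‖ z ‖ ≤ ‖ c ‖
‖root‖≤‖c‖ c z {e} c+ze≡0 e≢0 = begin
  ‖ z ‖            ≤⟨ ‖x‖≤‖x*y‖ z e≢0 ⟩
  ‖ z *ᵍ e ‖       ≡⟨ ‖-x‖≡‖x‖ (z *ᵍ e) ⟨
  ‖ -ᵍ (z *ᵍ e) ‖  ≡⟨ cong ‖_‖ (x+y≡0⇒x≡-y c (z *ᵍ e) c+ze≡0) ⟨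
  ‖ c ‖            ∎
  where open ≤-Reasoning

eval₁-eventually-≢0 : ∀ {p} → NonZero₁ p → Eventually (λ z → eval₁ p z ≢ 0ᵍ)
eval₁-eventually-≢0 {c ∷ cs} (here c≢0) = ‖ c ‖ , nonroot
  where
  nonroot : ∀ z → ‖ c ‖ < ‖ z ‖ → eval₁ (c ∷ cs) z ≢ 0ᵍ
  nonroot z ‖c‖<‖z‖ p[z]≡0 with eval₁ cs z ≟ᵍ 0ᵍ
  ... | no  e≢0 = <⇒≱ ‖c‖<‖z‖ (‖root‖≤‖c‖ c z p[z]≡0 e≢0)
  ... | yes e≡0 = c≢0 (begin
    c                          ≡⟨ solve (c ∷ z ∷ []) ℤ[i]-ring ⟩
    c +ᵍ z *ᵍ 0ᵍ               ≡⟨ cong (λ e → c +ᵍ z *ᵍ e) e≡0 ⟨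
    c +ᵍ z *ᵍ eval₁ cs z       ≡⟨ p[z]≡0 ⟩
    0ᵍ                         ∎)
    where open ≡-Reasoning
eval₁-eventually-≢0 {c ∷ cs} (there cs≢0) = K ⊔ ‖ c ‖ , nonroot
  where
  K = proj₁ (eval₁-eventually-≢0 cs≢0)
  nonroot : ∀ z → K ⊔ ‖ c ‖ < ‖ z ‖ → eval₁ (c ∷ cs) z ≢ 0ᵍ
  nonroot z K⊔‖c‖<‖z‖ p[z]≡0 =
    <⇒≱ (m⊔n<o⇒n<o K ‖ c ‖ K⊔‖c‖<‖z‖)
        (‖root‖≤‖c‖ c z p[z]≡0 (proj₂ (eval₁-eventually-≢0 cs≢0) z (m⊔n<o⇒m<o K ‖ c ‖ K⊔‖c‖<‖z‖)))

evalʸ : Poly₂ → ℤ[i] → Poly₁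
evalʸ f y = map (λ q → eval₁ q y) f

eval₁-evalʸ : ∀ f x y → eval₁ (evalʸ f y) x ≡ eval₂ f x y
eval₁-evalʸ []      x y = refl
eval₁-evalʸ (q ∷ f) x y = cong (λ e → eval₁ q y +ᵍ x *ᵍ e) (eval₁-evalʸ f x y)

evalʸ-eventually-NonZero₁ : ∀ {f} → NonZeroPoly f → Eventually (λ y → NonZero₁ (evalʸ f y))
evalʸ-eventually-NonZero₁ (here q≢0)  = Eventually-map here (eval₁-eventually-≢0 q≢0)
evalʸ-eventually-NonZero₁ (there f≢0) = Eventually-map there (evalʸ-eventually-NonZero₁ f≢0)

ZariskiDense-criterion : ∀ {S} → Unbounded (λ y → Unbounded (λ x → S x y)) → ZariskiDense S
ZariskiDense-criterion S-unbounded f f≢0 =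
  let (y , f[·,y]≢0 , S[·,y]-unbounded) =
        Eventually∧Unbounded⇒∃ (evalʸ-eventually-NonZero₁ f≢0) S-unbounded
      (x , f[x,y]≢0 , Sxy) =
        Eventually∧Unbounded⇒∃ (eval₁-eventually-≢0 f[·,y]≢0) S[·,y]-unbounded
  in x , y , Sxy , f[x,y]≢0 ∘ trans (eval₁-evalʸ f x y)

ZariskiDense-⊤ : ZariskiDense (λ _ _ → ⊤)
ZariskiDense-⊤ = ZariskiDense-criterion (Unbounded-map (λ _ → Unbounded-⊤) Unbounded-⊤)

eval₁-¬NonZero₁ : ∀ p y → ¬ NonZero₁ p → eval₁ p y ≡ 0ᵍ
eval₁-¬NonZero₁ []       y _      = refl
eval₁-¬NonZero₁ (c ∷ cs) y p≡0 = begin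
  c +ᵍ y *ᵍ eval₁ cs y ≡⟨ cong₂ (λ c e → c +ᵍ y *ᵍ e) c≡0 (eval₁-¬NonZero₁ cs y (p≡0 ∘ there)) ⟩
  0ᵍ +ᵍ y *ᵍ 0ᵍ        ≡⟨ solve (y ∷ []) ℤ[i]-ring ⟩
  0ᵍ                   ∎
  where
  open ≡-Reasoning
  c≡0 : c ≡ 0ᵍ
  c≡0 = decidable-stable (c ≟ᵍ 0ᵍ) (p≡0 ∘ here)

eval₂-¬NonZeroPoly : ∀ f x y → ¬ NonZeroPoly f → eval₂ f x y ≡ 0ᵍ
eval₂-¬NonZeroPoly []      x y _   = refl
eval₂-¬NonZeroPoly (q ∷ f) x y f≡0 = begin
  eval₁ q y +ᵍ x *ᵍ eval₂ f x y
    ≡⟨ cong₂ (λ e e′ → e +ᵍ x *ᵍ e′) (eval₁-¬NonZero₁ q y (f≡0 ∘ here))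
                                      (eval₂-¬NonZeroPoly f x y (f≡0 ∘ there)) ⟩
  0ᵍ +ᵍ x *ᵍ 0ᵍ
    ≡⟨ solve (x ∷ []) ℤ[i]-ring ⟩
  0ᵍ ∎
  where open ≡-Reasoning

nonroot⇒NonZeroPoly : ∀ f x y → eval₂ f x y ≢ 0ᵍ → NonZeroPoly f
nonroot⇒NonZeroPoly f x y f[x,y]≢0 =
  decidable-stable (any? (any? (λ c → ¬? (c ≟ᵍ 0ᵍ))) f) (f[x,y]≢0 ∘ eval₂-¬NonZeroPoly f x y)

infixl 6 _+₁_ _+₂_
infixr 7 _·₁_ _·₂_ _*ˡ_ X·_ Y·_

_+₁_ : Poly₁ → Poly₁ → Poly₁
[]       +₁ q        = q
(c ∷ p)  +₁ []       = c ∷ p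
(c ∷ p)  +₁ (d ∷ q)  = c +ᵍ d ∷ p +₁ q

_+₂_ : Poly₂ → Poly₂ → Poly₂
[]       +₂ g        = g
(p ∷ f)  +₂ []       = p ∷ f
(p ∷ f)  +₂ (q ∷ g)  = p +₁ q ∷ f +₂ g

_·₁_ : ℤ[i] → Poly₁ → Poly₁
a ·₁ p = map (a *ᵍ_) p

_·₂_ : ℤ[i] → Poly₂ → Poly₂
a ·₂ f = map (a ·₁_) f

record LinearForm : Set where
  constructor _X+_Y
  field
    coeffˣ coeffʸ : ℤ[i]

⟦_⟧ : LinearForm → ℤ[i] → ℤ[i] → ℤ[i]
⟦ α X+ β Y ⟧ x y = α *ᵍ x +ᵍ β *ᵍ y

X·_ Y·_ : Poly₂ → Poly₂
X· f = [] ∷ f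
Y· f = map (0ᵍ ∷_) f

_*ˡ_ : LinearForm → Poly₂ → Poly₂
(α X+ β Y) *ˡ f = α ·₂ X· f +₂ β ·₂ Y· f

substitute₁ : Poly₁ → LinearForm → Poly₂
substitute₁ []       ℓ = []
substitute₁ (c ∷ cs) ℓ = ((c ∷ []) ∷ []) +₂ ℓ *ˡ substitute₁ cs ℓ

substitute : Poly₂ → LinearForm → LinearForm → Poly₂
substitute []      ℓ₁ ℓ₂ = []
substitute (q ∷ f) ℓ₁ ℓ₂ = substitute₁ q ℓ₂ +₂ ℓ₁ *ˡ substitute f ℓ₁ ℓ₂

private
  horner-+ : ∀ c d y e e′ → (c +ᵍ d) +ᵍ y *ᵍ (e +ᵍ e′) ≡ (c +ᵍ y *ᵍ e) +ᵍ (d +ᵍ y *ᵍ e′)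
  horner-+ = solve-∀ ℤ[i]-ring
  horner-· : ∀ a c y e → a *ᵍ c +ᵍ y *ᵍ (a *ᵍ e) ≡ a *ᵍ (c +ᵍ y *ᵍ e)
  horner-· = solve-∀ ℤ[i]-ring
  e≡0+e : ∀ e → e ≡ 0ᵍ +ᵍ e
  e≡0+e = solve-∀ ℤ[i]-ring
  e≡e+0 : ∀ e → e ≡ e +ᵍ 0ᵍ
  e≡e+0 = solve-∀ ℤ[i]-ring
  0≡a*0 : ∀ a → 0ᵍ ≡ a *ᵍ 0ᵍ
  0≡a*0 = solve-∀ ℤ[i]-ring

eval₁-+₁ : ∀ p q y → eval₁ (p +₁ q) y ≡ eval₁ p y +ᵍ eval₁ q y
eval₁-+₁ []      q       y = e≡0+e (eval₁ q y)
eval₁-+₁ (c ∷ p) []      y = e≡e+0 (eval₁ (c ∷ p) y)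
eval₁-+₁ (c ∷ p) (d ∷ q) y =
  trans (cong (λ e → (c +ᵍ d) +ᵍ y *ᵍ e) (eval₁-+₁ p q y)) (horner-+ c d y (eval₁ p y) (eval₁ q y))

eval₂-+₂ : ∀ f g x y → eval₂ (f +₂ g) x y ≡ eval₂ f x y +ᵍ eval₂ g x y
eval₂-+₂ []      g       x y = e≡0+e (eval₂ g x y)
eval₂-+₂ (p ∷ f) []      x y = e≡e+0 (eval₂ (p ∷ f) x y)
eval₂-+₂ (p ∷ f) (q ∷ g) x y =
  trans (cong₂ (λ e e′ → e +ᵍ x *ᵍ e′) (eval₁-+₁ p q y) (eval₂-+₂ f g x y))
        (horner-+ (eval₁ p y) (eval₁ q y) x (eval₂ f x y) (eval₂ g x y))

eval₁-·₁ : ∀ a p y → eval₁ (a ·₁ p) y ≡ a *ᵍ eval₁ p y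
eval₁-·₁ a []      y = 0≡a*0 a
eval₁-·₁ a (c ∷ p) y =
  trans (cong (λ e → a *ᵍ c +ᵍ y *ᵍ e) (eval₁-·₁ a p y)) (horner-· a c y (eval₁ p y))

eval₂-·₂ : ∀ a f x y → eval₂ (a ·₂ f) x y ≡ a *ᵍ eval₂ f x y
eval₂-·₂ a []      x y = 0≡a*0 a
eval₂-·₂ a (p ∷ f) x y =
  trans (cong₂ (λ e e′ → e +ᵍ x *ᵍ e′) (eval₁-·₁ a p y) (eval₂-·₂ a f x y))
        (horner-· a (eval₁ p y) x (eval₂ f x y))

eval₂-Y· : ∀ f x y → eval₂ (Y· f) x y ≡ y *ᵍ eval₂ f x y
eval₂-Y· []      x y = 0≡a*0 y
eval₂-Y· (q ∷ f) x y =
  trans (cong (λ e → (0ᵍ +ᵍ y *ᵍ eval₁ q y) +ᵍ x *ᵍ e) (eval₂-Y· f x y))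
        (shift x y (eval₁ q y) (eval₂ f x y))
  where
  shift : ∀ x y e e′ → (0ᵍ +ᵍ y *ᵍ e) +ᵍ x *ᵍ (y *ᵍ e′) ≡ y *ᵍ (e +ᵍ x *ᵍ e′)
  shift = solve-∀ ℤ[i]-ring

eval₂-*ˡ : ∀ ℓ f x y → eval₂ (ℓ *ˡ f) x y ≡ ⟦ ℓ ⟧ x y *ᵍ eval₂ f x y
eval₂-*ˡ ℓ@(α X+ β Y) f x y = begin
  eval₂ (α ·₂ X· f +₂ β ·₂ Y· f) x y
    ≡⟨ eval₂-+₂ (α ·₂ X· f) (β ·₂ Y· f) x y ⟩
  eval₂ (α ·₂ X· f) x y +ᵍ eval₂ (β ·₂ Y· f) x y
    ≡⟨ cong₂ _+ᵍ_ (eval₂-·₂ α (X· f) x y) (eval₂-·₂ β (Y· f) x y) ⟩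
  α *ᵍ (0ᵍ +ᵍ x *ᵍ eval₂ f x y) +ᵍ β *ᵍ eval₂ (Y· f) x y
    ≡⟨ cong (λ e → α *ᵍ (0ᵍ +ᵍ x *ᵍ eval₂ f x y) +ᵍ β *ᵍ e) (eval₂-Y· f x y) ⟩
  α *ᵍ (0ᵍ +ᵍ x *ᵍ eval₂ f x y) +ᵍ β *ᵍ (y *ᵍ eval₂ f x y)
    ≡⟨ linear-factor α β x y (eval₂ f x y) ⟩
  ⟦ ℓ ⟧ x y *ᵍ eval₂ f x y ∎
  where
  open ≡-Reasoning
  linear-factor : ∀ α β x y e → α *ᵍ (0ᵍ +ᵍ x *ᵍ e) +ᵍ β *ᵍ (y *ᵍ e) ≡ (α *ᵍ x +ᵍ β *ᵍ y) *ᵍ e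
  linear-factor = solve-∀ ℤ[i]-ring

eval₂-substitute₁ : ∀ q ℓ x y → eval₂ (substitute₁ q ℓ) x y ≡ eval₁ q (⟦ ℓ ⟧ x y)
eval₂-substitute₁ []       ℓ x y = refl
eval₂-substitute₁ (c ∷ cs) ℓ x y = begin
  eval₂ (((c ∷ []) ∷ []) +₂ ℓ *ˡ substitute₁ cs ℓ) x y
    ≡⟨ eval₂-+₂ ((c ∷ []) ∷ []) (ℓ *ˡ substitute₁ cs ℓ) x y ⟩
  ((c +ᵍ y *ᵍ 0ᵍ) +ᵍ x *ᵍ 0ᵍ) +ᵍ eval₂ (ℓ *ˡ substitute₁ cs ℓ) x y
    ≡⟨ cong₂ _+ᵍ_ (eval₂-constant c x y) (eval₂-*ˡ ℓ (substitute₁ cs ℓ) x y) ⟩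
  c +ᵍ ⟦ ℓ ⟧ x y *ᵍ eval₂ (substitute₁ cs ℓ) x y
    ≡⟨ cong (λ e → c +ᵍ ⟦ ℓ ⟧ x y *ᵍ e) (eval₂-substitute₁ cs ℓ x y) ⟩
  c +ᵍ ⟦ ℓ ⟧ x y *ᵍ eval₁ cs (⟦ ℓ ⟧ x y) ∎
  where
  open ≡-Reasoning
  eval₂-constant : ∀ c x y → (c +ᵍ y *ᵍ 0ᵍ) +ᵍ x *ᵍ 0ᵍ ≡ c
  eval₂-constant = solve-∀ ℤ[i]-ring

eval₂-substitute : ∀ f ℓ₁ ℓ₂ x y → eval₂ (substitute f ℓ₁ ℓ₂) x y ≡ eval₂ f (⟦ ℓ₁ ⟧ x y) (⟦ ℓ₂ ⟧ x y)
eval₂-substitute []      ℓ₁ ℓ₂ x y = refl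
eval₂-substitute (q ∷ f) ℓ₁ ℓ₂ x y = begin
  eval₂ (substitute₁ q ℓ₂ +₂ ℓ₁ *ˡ substitute f ℓ₁ ℓ₂) x y
    ≡⟨ eval₂-+₂ (substitute₁ q ℓ₂) (ℓ₁ *ˡ substitute f ℓ₁ ℓ₂) x y ⟩
  eval₂ (substitute₁ q ℓ₂) x y +ᵍ eval₂ (ℓ₁ *ˡ substitute f ℓ₁ ℓ₂) x y
    ≡⟨ cong₂ _+ᵍ_ (eval₂-substitute₁ q ℓ₂ x y) (eval₂-*ˡ ℓ₁ (substitute f ℓ₁ ℓ₂) x y) ⟩
  eval₁ q (⟦ ℓ₂ ⟧ x y) +ᵍ ⟦ ℓ₁ ⟧ x y *ᵍ eval₂ (substitute f ℓ₁ ℓ₂) x y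
    ≡⟨ cong (λ e → eval₁ q (⟦ ℓ₂ ⟧ x y) +ᵍ ⟦ ℓ₁ ⟧ x y *ᵍ e) (eval₂-substitute f ℓ₁ ℓ₂ x y) ⟩
  eval₂ (q ∷ f) (⟦ ℓ₁ ⟧ x y) (⟦ ℓ₂ ⟧ x y) ∎
  where open ≡-Reasoning

Surjective : LinearForm → LinearForm → Set
Surjective ℓ₁ ℓ₂ = ∀ x y → ∃₂ λ u v → ⟦ ℓ₁ ⟧ u v ≡ x × ⟦ ℓ₂ ⟧ u v ≡ y

substitute-NonZeroPoly : ∀ {f ℓ₁ ℓ₂} → Surjective ℓ₁ ℓ₂ →
  NonZeroPoly f → NonZeroPoly (substitute f ℓ₁ ℓ₂)
substitute-NonZeroPoly {f} {ℓ₁} {ℓ₂} onto f≢0 =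
  let (x , y , _ , f[x,y]≢0) = ZariskiDense-⊤ f f≢0
      (u , v , ℓ₁≡x , ℓ₂≡y) = onto x y
  in nonroot⇒NonZeroPoly (substitute f ℓ₁ ℓ₂) u v λ g[u,v]≡0 →
       f[x,y]≢0 (begin
         eval₂ f x y                            ≡⟨ cong₂ (eval₂ f) ℓ₁≡x ℓ₂≡y ⟨
         eval₂ f (⟦ ℓ₁ ⟧ u v) (⟦ ℓ₂ ⟧ u v)      ≡⟨ eval₂-substitute f ℓ₁ ℓ₂ u v ⟨
         eval₂ (substitute f ℓ₁ ℓ₂) u v         ≡⟨ g[u,v]≡0 ⟩
         0ᵍ                                     ∎)
  where open ≡-Reasoning

ZariskiDense-substitute : ∀ {S} ℓ₁ ℓ₂ → Surjective ℓ₁ ℓ₂ →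
  ZariskiDense (λ u v → S (⟦ ℓ₁ ⟧ u v) (⟦ ℓ₂ ⟧ u v)) → ZariskiDense S
ZariskiDense-substitute ℓ₁ ℓ₂ onto dense f f≢0 =
  let (u , v , S[ℓ₁,ℓ₂] , g[u,v]≢0) = dense (substitute f ℓ₁ ℓ₂) (substitute-NonZeroPoly onto f≢0)
  in ⟦ ℓ₁ ⟧ u v , ⟦ ℓ₂ ⟧ u v , S[ℓ₁,ℓ₂] , g[u,v]≢0 ∘ trans (eval₂-substitute f ℓ₁ ℓ₂ u v)

-- Parity in ℤ[i]

1+i 1-i : ℤ[i]
1+i = (+ 1) + (+ 1) i
1-i = (+ 1) + -[1+ 0 ] i

infix 4 _∣ᵍ_

_∣ᵍ_ : ℤ[i] → ℤ[i] → Set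
d ∣ᵍ z = ∃ λ q → z ≡ d *ᵍ q

Odd : ℤ[i] → Set
Odd z = ∃ λ α → z ≡ 1ᵍ +ᵍ 1+i *ᵍ α

Odd-1 : Odd 1ᵍ
Odd-1 = 0ᵍ , refl

Odd-* : ∀ {x y} → Odd x → Odd y → Odd (x *ᵍ y)
Odd-* (α , refl) (β , refl) = α +ᵍ β +ᵍ 1+i *ᵍ α *ᵍ β , solve (α ∷ β ∷ []) ℤ[i]-ring

Odd-+ : ∀ {x} → Odd x → ∀ y → Odd (x +ᵍ 1+i *ᵍ y)
Odd-+ (α , refl) y = α +ᵍ y , solve (α ∷ y ∷ []) ℤ[i]-ring

2∣odd²-odd² : ∀ {s s′} → Odd s → Odd s′ → 2ᵍ ∣ᵍ s *ᵍ s -ᵍ s′ *ᵍ s′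
2∣odd²-odd² (α , refl) (β , refl) =
  1+i *ᵍ (α -ᵍ β) +ᵍ iᵍ *ᵍ (α *ᵍ α -ᵍ β *ᵍ β) , solve (α ∷ β ∷ []) ℤ[i]-ring

d∣c⊎d∣x-y⇒d∣cx-cy : ∀ {d c} x y → d ∣ᵍ c ⊎ d ∣ᵍ x -ᵍ y → d ∣ᵍ c *ᵍ x -ᵍ c *ᵍ y
d∣c⊎d∣x-y⇒d∣cx-cy {d} x y (inj₁ (γ , refl)) = γ *ᵍ (x -ᵍ y) , solve (d ∷ γ ∷ x ∷ y ∷ []) ℤ[i]-ring
d∣c⊎d∣x-y⇒d∣cx-cy {d} {c} x y (inj₂ (k , x-y≡dk)) = c *ᵍ k , (begin
  c *ᵍ x -ᵍ c *ᵍ y   ≡⟨ solve (c ∷ x ∷ y ∷ []) ℤ[i]-ring ⟩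
  c *ᵍ (x -ᵍ y)      ≡⟨ cong (c *ᵍ_) x-y≡dk ⟩
  c *ᵍ (d *ᵍ k)      ≡⟨ solve (c ∷ d ∷ k ∷ []) ℤ[i]-ring ⟩
  d *ᵍ (c *ᵍ k)      ∎)
  where open ≡-Reasoning

-- Orbits of a Pell-type automorphism

module PellOrbit (c δ p m : ℤ[i]) (pell : p *ᵍ p -ᵍ c *ᵍ δ *ᵍ m *ᵍ m ≡ 1ᵍ) where

  step : ℤ[i] × ℤ[i] → ℤ[i] × ℤ[i]
  step (s , t) = p *ᵍ s +ᵍ δ *ᵍ m *ᵍ t , c *ᵍ m *ᵍ s +ᵍ p *ᵍ t

  form : ℤ[i] × ℤ[i] → ℤ[i]
  form (s , t) = c *ᵍ (s *ᵍ s) -ᵍ δ *ᵍ (t *ᵍ t)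

  orbit : ℤ[i] × ℤ[i] → ℕ → ℤ[i] × ℤ[i]
  orbit st zero    = st
  orbit st (suc n) = step (orbit st n)

  form-step : ∀ st → form (step st) ≡ form st
  form-step (s , t) = begin
    c *ᵍ ((p *ᵍ s +ᵍ δ *ᵍ m *ᵍ t) *ᵍ (p *ᵍ s +ᵍ δ *ᵍ m *ᵍ t))
      -ᵍ δ *ᵍ ((c *ᵍ m *ᵍ s +ᵍ p *ᵍ t) *ᵍ (c *ᵍ m *ᵍ s +ᵍ p *ᵍ t))
      ≡⟨ solve (c ∷ δ ∷ p ∷ m ∷ s ∷ t ∷ []) ℤ[i]-ring ⟩
    (p *ᵍ p -ᵍ c *ᵍ δ *ᵍ m *ᵍ m) *ᵍ (c *ᵍ (s *ᵍ s) -ᵍ δ *ᵍ (t *ᵍ t))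
      ≡⟨ cong (_*ᵍ (c *ᵍ (s *ᵍ s) -ᵍ δ *ᵍ (t *ᵍ t))) pell ⟩
    1ᵍ *ᵍ (c *ᵍ (s *ᵍ s) -ᵍ δ *ᵍ (t *ᵍ t))
      ≡⟨ solve (c ∷ δ ∷ s ∷ t ∷ []) ℤ[i]-ring ⟩
    c *ᵍ (s *ᵍ s) -ᵍ δ *ᵍ (t *ᵍ t) ∎
    where open ≡-Reasoning

  form-orbit : ∀ st n → form (orbit st n) ≡ form st
  form-orbit st zero    = refl
  form-orbit st (suc n) = trans (form-step (orbit st n)) (form-orbit st n)

  step²-recurrence : ∀ s t → proj₁ (step (step (s , t))) ≡ (p +ᵍ p) *ᵍ proj₁ (step (s , t)) -ᵍ s
  step²-recurrence s t = begin
    p *ᵍ (p *ᵍ s +ᵍ δ *ᵍ m *ᵍ t) +ᵍ δ *ᵍ m *ᵍ (c *ᵍ m *ᵍ s +ᵍ p *ᵍ t)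
      ≡⟨ solve (c ∷ δ ∷ p ∷ m ∷ s ∷ t ∷ []) ℤ[i]-ring ⟩
    (p +ᵍ p) *ᵍ (p *ᵍ s +ᵍ δ *ᵍ m *ᵍ t) -ᵍ (p *ᵍ p -ᵍ c *ᵍ δ *ᵍ m *ᵍ m) *ᵍ s
      ≡⟨ cong (λ w → (p +ᵍ p) *ᵍ (p *ᵍ s +ᵍ δ *ᵍ m *ᵍ t) -ᵍ w *ᵍ s) pell ⟩
    (p +ᵍ p) *ᵍ (p *ᵍ s +ᵍ δ *ᵍ m *ᵍ t) -ᵍ 1ᵍ *ᵍ s
      ≡⟨ solve (δ ∷ p ∷ m ∷ s ∷ t ∷ []) ℤ[i]-ring ⟩
    (p +ᵍ p) *ᵍ (p *ᵍ s +ᵍ δ *ᵍ m *ᵍ t) -ᵍ s ∎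
    where open ≡-Reasoning

  orbit-recurrence : ∀ st n →
    proj₁ (orbit st (suc (suc n))) ≡ (p +ᵍ p) *ᵍ proj₁ (orbit st (suc n)) -ᵍ proj₁ (orbit st n)
  orbit-recurrence st n = step²-recurrence (proj₁ (orbit st n)) (proj₂ (orbit st n))

  Odd-step : Odd p → 1+i ∣ᵍ m → ∀ s t → Odd s → Odd (proj₁ (step (s , t)))
  Odd-step odd-p (μ , m≡[1+i]μ) s t odd-s =
    subst Odd (sym ps+δmt≡ps+[1+i]δμt) (Odd-+ (Odd-* odd-p odd-s) (δ *ᵍ μ *ᵍ t))
    where
    open ≡-Reasoning
    ps+δmt≡ps+[1+i]δμt : p *ᵍ s +ᵍ δ *ᵍ m *ᵍ t ≡ p *ᵍ s +ᵍ 1+i *ᵍ (δ *ᵍ μ *ᵍ t)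
    ps+δmt≡ps+[1+i]δμt = begin
      p *ᵍ s +ᵍ δ *ᵍ m *ᵍ t            ≡⟨ cong (λ w → p *ᵍ s +ᵍ δ *ᵍ w *ᵍ t) m≡[1+i]μ ⟩
      p *ᵍ s +ᵍ δ *ᵍ (1+i *ᵍ μ) *ᵍ t   ≡⟨ solve (p ∷ s ∷ δ ∷ μ ∷ t ∷ []) ℤ[i]-ring ⟩
      p *ᵍ s +ᵍ 1+i *ᵍ (δ *ᵍ μ *ᵍ t)   ∎

  Odd-orbit : Odd p → 1+i ∣ᵍ m → ∀ st → Odd (proj₁ st) → ∀ n → Odd (proj₁ (orbit st n))
  Odd-orbit odd-p 1+i∣m st odd-s zero    = odd-s
  Odd-orbit odd-p 1+i∣m st odd-s (suc n) =
    Odd-step odd-p 1+i∣m _ (proj₂ (orbit st n)) (Odd-orbit odd-p 1+i∣m st odd-s n)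

-- S₂ in the coordinates u = x + iy, v = x − iy, where c = A + iB and c′ = A − iB
-- (see S₂-light-cone).
Admissible : ℤ[i] → ℤ[i] → ℤ[i] → ℤ[i] → Set
Admissible c c′ u v = IsSquare (u *ᵍ v) × IsSquare ((u -ᵍ c) *ᵍ (v -ᵍ c′))

IsSquare-a²s²s′² : ∀ a s s′ → IsSquare ((a *ᵍ (s *ᵍ s)) *ᵍ (a *ᵍ (s′ *ᵍ s′)))
IsSquare-a²s²s′² a s s′ = a *ᵍ s *ᵍ s′ , solve (a ∷ s ∷ s′ ∷ []) ℤ[i]-ring

record Parameters (c c′ : ℤ[i]) : Set where
  field
    σ m     : ℤ[i]
    σ+σ≡c′m : σ +ᵍ σ ≡ c′ *ᵍ m
    8≤‖m‖   : 8 ≤ ‖ m ‖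
    parity  : 2ᵍ ∣ᵍ c ⊎ (Odd σ × 1+i ∣ᵍ m)

module PellConstruction {c c′ σ m : ℤ[i]} (c≢0 : c ≢ 0ᵍ) (c′≢0 : c′ ≢ 0ᵍ)
  (σ+σ≡c′m : σ +ᵍ σ ≡ c′ *ᵍ m) (8≤‖m‖ : 8 ≤ ‖ m ‖) (parity : 2ᵍ ∣ᵍ c ⊎ (Odd σ × 1+i ∣ᵍ m)) where

  δ p : ℤ[i]
  δ = c *ᵍ (σ *ᵍ σ) -ᵍ c′
  p = c *ᵍ σ *ᵍ m -ᵍ 1ᵍ

  pell : p *ᵍ p -ᵍ c *ᵍ δ *ᵍ m *ᵍ m ≡ 1ᵍ
  pell = begin
    (c *ᵍ σ *ᵍ m -ᵍ 1ᵍ) *ᵍ (c *ᵍ σ *ᵍ m -ᵍ 1ᵍ) -ᵍ c *ᵍ (c *ᵍ (σ *ᵍ σ) -ᵍ c′) *ᵍ m *ᵍ m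
      ≡⟨ solve (c ∷ c′ ∷ σ ∷ m ∷ []) ℤ[i]-ring ⟩
    1ᵍ +ᵍ c *ᵍ m *ᵍ (c′ *ᵍ m -ᵍ (σ +ᵍ σ))
      ≡⟨ cong (λ w → 1ᵍ +ᵍ c *ᵍ m *ᵍ (c′ *ᵍ m -ᵍ w)) σ+σ≡c′m ⟩
    1ᵍ +ᵍ c *ᵍ m *ᵍ (c′ *ᵍ m -ᵍ c′ *ᵍ m)
      ≡⟨ solve (c ∷ c′ ∷ m ∷ []) ℤ[i]-ring ⟩
    1ᵍ ∎
    where open ≡-Reasoning

  open PellOrbit c δ p m pell

  sA tA sB tB u v : ℕ → ℤ[i]
  sA n = proj₁ (orbit (1ᵍ , 0ᵍ) n)
  tA n = proj₂ (orbit (1ᵍ , 0ᵍ) n)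
  sB n = proj₁ (orbit (σ , 1ᵍ) n)
  tB n = proj₂ (orbit (σ , 1ᵍ) n)
  u n  = c *ᵍ (sA n *ᵍ sA n)
  v n  = c *ᵍ (sB n *ᵍ sB n)

  u-c≡δtA² : ∀ n → u n -ᵍ c ≡ δ *ᵍ (tA n *ᵍ tA n)
  u-c≡δtA² n = x-y≡z⇒x-z≡y (u n) (δ *ᵍ (tA n *ᵍ tA n))
                 (trans (form-orbit (1ᵍ , 0ᵍ) n) (form[1,0] c δ))
    where
    form[1,0] : ∀ c δ → c *ᵍ (1ᵍ *ᵍ 1ᵍ) -ᵍ δ *ᵍ (0ᵍ *ᵍ 0ᵍ) ≡ c
    form[1,0] = solve-∀ ℤ[i]-ring

  v-c′≡δtB² : ∀ n → v n -ᵍ c′ ≡ δ *ᵍ (tB n *ᵍ tB n)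
  v-c′≡δtB² n = x-y≡z⇒x-z≡y (v n) (δ *ᵍ (tB n *ᵍ tB n))
                  (trans (form-orbit (σ , 1ᵍ) n) (form[σ,1] c c′ σ))
    where
    form[σ,1] : ∀ c c′ σ → c *ᵍ (σ *ᵍ σ) -ᵍ (c *ᵍ (σ *ᵍ σ) -ᵍ c′) *ᵍ (1ᵍ *ᵍ 1ᵍ) ≡ c′
    form[σ,1] = solve-∀ ℤ[i]-ring

  admissible : ∀ n n′ → Admissible c c′ (u n) (v n′)
  admissible n n′ =
    IsSquare-a²s²s′² c (sA n) (sB n′) ,
    subst IsSquare (sym (cong₂ _*ᵍ_ (u-c≡δtA² n) (v-c′≡δtB² n′))) (IsSquare-a²s²s′² δ (tA n) (tB n′))

  m²c′c≡2cσm : m *ᵍ m *ᵍ c′ *ᵍ c ≡ c *ᵍ σ *ᵍ m +ᵍ c *ᵍ σ *ᵍ m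
  m²c′c≡2cσm = begin
    m *ᵍ m *ᵍ c′ *ᵍ c            ≡⟨ solve (c ∷ c′ ∷ m ∷ []) ℤ[i]-ring ⟩
    c *ᵍ (c′ *ᵍ m) *ᵍ m          ≡⟨ cong (λ w → c *ᵍ w *ᵍ m) σ+σ≡c′m ⟨
    c *ᵍ (σ +ᵍ σ) *ᵍ m           ≡⟨ solve (c ∷ σ ∷ m ∷ []) ℤ[i]-ring ⟩
    c *ᵍ σ *ᵍ m +ᵍ c *ᵍ σ *ᵍ m   ∎
    where open ≡-Reasoning

  4≤‖p‖ : 4 ≤ ‖ p ‖
  4≤‖p‖ = 16≤‖z‖⇒4≤‖z-1‖ (c *ᵍ σ *ᵍ m) (*-cancelˡ-≤ 4 (begin
    4 * 16                           ≤⟨ *-mono-≤ 8≤‖m‖ 8≤‖m‖ ⟩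
    ‖ m ‖ * ‖ m ‖                    ≡⟨ ‖x*y‖≡‖x‖*‖y‖ m m ⟨
    ‖ m *ᵍ m ‖                       ≤⟨ ‖x‖≤‖x*y‖ (m *ᵍ m) c′≢0 ⟩
    ‖ m *ᵍ m *ᵍ c′ ‖                 ≤⟨ ‖x‖≤‖x*y‖ (m *ᵍ m *ᵍ c′) c≢0 ⟩
    ‖ m *ᵍ m *ᵍ c′ *ᵍ c ‖            ≡⟨ cong ‖_‖ m²c′c≡2cσm ⟩
    ‖ c *ᵍ σ *ᵍ m +ᵍ c *ᵍ σ *ᵍ m ‖   ≡⟨ ‖x+x‖≡4*‖x‖ (c *ᵍ σ *ᵍ m) ⟩
    4 * ‖ c *ᵍ σ *ᵍ m ‖              ∎))
    where open ≤-Reasoning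

  σ≢0 : σ ≢ 0ᵍ
  σ≢0 σ≡0 = contradiction (subst (λ w → 4 ≤ ‖ w ‖) p≡-1 4≤‖p‖) λ { (s≤s ()) }
    where
    p≡-1 : p ≡ -ᵍ 1ᵍ
    p≡-1 = trans (cong (λ w → c *ᵍ w *ᵍ m -ᵍ 1ᵍ) σ≡0) (solve (c ∷ m ∷ []) ℤ[i]-ring)

  2p-1≢0 : (p +ᵍ p) -ᵍ 1ᵍ ≢ 0ᵍ
  2p-1≢0 = ‖x‖>0⇒x≢0 (≤-trans (s≤s z≤n) (16≤‖z‖⇒4≤‖z-1‖ (p +ᵍ p) 16≤‖2p‖))
    where
    16≤‖2p‖ : 16 ≤ ‖ p +ᵍ p ‖
    16≤‖2p‖ = subst (16 ≤_) (sym (‖x+x‖≡4*‖x‖ p)) (*-monoʳ-≤ 4 4≤‖p‖)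

  sA₁≡p : sA 1 ≡ p
  sA₁≡p = p*1+d*0≡p p (δ *ᵍ m)
    where
    p*1+d*0≡p : ∀ p d → p *ᵍ 1ᵍ +ᵍ d *ᵍ 0ᵍ ≡ p
    p*1+d*0≡p = solve-∀ ℤ[i]-ring

  sB₁≡σ[2p-1] : sB 1 ≡ σ *ᵍ ((p +ᵍ p) -ᵍ 1ᵍ)
  sB₁≡σ[2p-1] = begin
    (c *ᵍ σ *ᵍ m -ᵍ 1ᵍ) *ᵍ σ +ᵍ (c *ᵍ (σ *ᵍ σ) -ᵍ c′) *ᵍ m *ᵍ 1ᵍ
      ≡⟨ solve (c ∷ c′ ∷ σ ∷ m ∷ []) ℤ[i]-ring ⟩
    σ *ᵍ ((c *ᵍ σ *ᵍ m -ᵍ 1ᵍ +ᵍ (c *ᵍ σ *ᵍ m -ᵍ 1ᵍ)) -ᵍ 1ᵍ) +ᵍ ((σ +ᵍ σ) -ᵍ c′ *ᵍ m)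
      ≡⟨ cong (λ w → σ *ᵍ ((p +ᵍ p) -ᵍ 1ᵍ) +ᵍ (w -ᵍ c′ *ᵍ m)) σ+σ≡c′m ⟩
    σ *ᵍ ((c *ᵍ σ *ᵍ m -ᵍ 1ᵍ +ᵍ (c *ᵍ σ *ᵍ m -ᵍ 1ᵍ)) -ᵍ 1ᵍ) +ᵍ (c′ *ᵍ m -ᵍ c′ *ᵍ m)
      ≡⟨ solve (c ∷ c′ ∷ σ ∷ m ∷ []) ℤ[i]-ring ⟩
    σ *ᵍ ((c *ᵍ σ *ᵍ m -ᵍ 1ᵍ +ᵍ (c *ᵍ σ *ᵍ m -ᵍ 1ᵍ)) -ᵍ 1ᵍ) ∎
    where open ≡-Reasoning

  ‖u[1+n]‖>n : ∀ n → n < ‖ u (suc n) ‖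
  ‖u[1+n]‖>n n = <-≤-trans (‖sA[1+n]‖>n n) (‖s‖≤‖c*s²‖ (sA (suc n)) c≢0)
    where
    ‖sA[1+n]‖>n : ∀ n → n < ‖ sA (suc n) ‖
    ‖sA[1+n]‖>n = ‖s[1+n]‖>n sA p 4≤‖p‖ (orbit-recurrence (1ᵍ , 0ᵍ)) (s≤s z≤n)
                    (subst (λ w → 1 ≤ ‖ w ‖) (sym sA₁≡p) (≤-trans (s≤s z≤n) 4≤‖p‖))

  ‖v[1+n]‖>n : ∀ n → n < ‖ v (suc n) ‖
  ‖v[1+n]‖>n n = <-≤-trans (‖sB[1+n]‖>n n) (‖s‖≤‖c*s²‖ (sB (suc n)) c≢0)
    where
    ‖sB[1+n]‖>n : ∀ n → n < ‖ sB (suc n) ‖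
    ‖sB[1+n]‖>n = ‖s[1+n]‖>n sB p 4≤‖p‖ (orbit-recurrence (σ , 1ᵍ)) (x≢0⇒‖x‖>0 σ≢0)
                    (subst (λ w → ‖ σ ‖ ≤ ‖ w ‖) (sym sB₁≡σ[2p-1]) (‖x‖≤‖x*y‖ σ 2p-1≢0))

  Odd-p : 1+i ∣ᵍ m → Odd p
  Odd-p (μ , m≡[1+i]μ) = c *ᵍ σ *ᵍ μ -ᵍ 1-i , (begin
    c *ᵍ σ *ᵍ m -ᵍ 1ᵍ                     ≡⟨ cong (λ w → c *ᵍ σ *ᵍ w -ᵍ 1ᵍ) m≡[1+i]μ ⟩
    c *ᵍ σ *ᵍ (1+i *ᵍ μ) -ᵍ 1ᵍ            ≡⟨ solve (c ∷ σ ∷ μ ∷ []) ℤ[i]-ring ⟩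
    1ᵍ +ᵍ 1+i *ᵍ (c *ᵍ σ *ᵍ μ -ᵍ 1-i)     ∎)
    where open ≡-Reasoning

  2∣u-v : ∀ n n′ → 2ᵍ ∣ᵍ u n -ᵍ v n′
  2∣u-v n n′ =
    d∣c⊎d∣x-y⇒d∣cx-cy {2ᵍ} {c} (sA n *ᵍ sA n) (sB n′ *ᵍ sB n′) (Sum.map₂ 2∣sA²-sB² parity)
    where
    2∣sA²-sB² : Odd σ × 1+i ∣ᵍ m → 2ᵍ ∣ᵍ sA n *ᵍ sA n -ᵍ sB n′ *ᵍ sB n′
    2∣sA²-sB² (odd-σ , 1+i∣m) = 2∣odd²-odd² (Odd-orbit (Odd-p 1+i∣m) 1+i∣m (1ᵍ , 0ᵍ) Odd-1 n)
                                            (Odd-orbit (Odd-p 1+i∣m) 1+i∣m (σ , 1ᵍ) odd-σ n′)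

  admissible-unbounded :
    Unbounded (λ v′ → Unbounded (λ h → ∃ λ u′ → u′ -ᵍ v′ ≡ 2ᵍ *ᵍ h × Admissible c c′ u′ v′))
  admissible-unbounded K = v (suc K) , ‖v[1+n]‖>n K , λ K′ →
    let n = suc (8 * K′ + 2 * ‖ v (suc K) ‖)
        (h , u-v≡2h) = 2∣u-v n (suc K)
    in h , half-difference-large (u n) (v (suc K)) h K′ u-v≡2h (‖u[1+n]‖>n _) ,
       u n , u-v≡2h , admissible n (suc K)

S₂ : ℤ[i] → ℤ[i] → ℤ[i] → ℤ[i] → Set
S₂ A B x y = IsSquare (x *ᵍ x +ᵍ y *ᵍ y) × IsSquare ((x -ᵍ A) *ᵍ (x -ᵍ A) +ᵍ (y -ᵍ B) *ᵍ (y -ᵍ B))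

-- (h, v) ↦ (x, y) = (h + v, −ih), so that x + iy = v + 2h and x − iy = v.
ℓˣ ℓʸ : LinearForm
ℓˣ = 1ᵍ X+ 1ᵍ Y
ℓʸ = (-ᵍ iᵍ) X+ 0ᵍ Y

ℓˣℓʸ-surjective : Surjective ℓˣ ℓʸ
ℓˣℓʸ-surjective x y = iᵍ *ᵍ y , x -ᵍ iᵍ *ᵍ y , ℓˣ≡x x y , ℓʸ≡y x y
  where
  ℓˣ≡x : ∀ x y → 1ᵍ *ᵍ (iᵍ *ᵍ y) +ᵍ 1ᵍ *ᵍ (x -ᵍ iᵍ *ᵍ y) ≡ x
  ℓˣ≡x = solve-∀ ℤ[i]-ring
  ℓʸ≡y : ∀ x y → (-ᵍ iᵍ) *ᵍ (iᵍ *ᵍ y) +ᵍ 0ᵍ *ᵍ (x -ᵍ iᵍ *ᵍ y) ≡ y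
  ℓʸ≡y = solve-∀ ℤ[i]-ring

S₂-light-cone : ∀ A B u v h → u -ᵍ v ≡ 2ᵍ *ᵍ h →
  Admissible (A +ᵍ iᵍ *ᵍ B) (A -ᵍ iᵍ *ᵍ B) u v → S₂ A B (⟦ ℓˣ ⟧ h v) (⟦ ℓʸ ⟧ h v)
S₂-light-cone A B u v h u-v≡2h (uv-square , [u-c][v-c′]-square) =
  subst IsSquare (sym x²+y²≡uv) uv-square ,
  subst IsSquare (sym [x-A]²+[y-B]²≡[u-c][v-c′]) [u-c][v-c′]-square
  where
  open ≡-Reasoning
  x = 1ᵍ *ᵍ h +ᵍ 1ᵍ *ᵍ v
  y = (-ᵍ iᵍ) *ᵍ h +ᵍ 0ᵍ *ᵍ v
  x²+y²≡uv : x *ᵍ x +ᵍ y *ᵍ y ≡ u *ᵍ v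
  x²+y²≡uv = begin
    (1ᵍ *ᵍ h +ᵍ 1ᵍ *ᵍ v) *ᵍ (1ᵍ *ᵍ h +ᵍ 1ᵍ *ᵍ v)
      +ᵍ ((-ᵍ iᵍ) *ᵍ h +ᵍ 0ᵍ *ᵍ v) *ᵍ ((-ᵍ iᵍ) *ᵍ h +ᵍ 0ᵍ *ᵍ v)
      ≡⟨ solve (h ∷ v ∷ []) ℤ[i]-ring ⟩
    (v +ᵍ 2ᵍ *ᵍ h) *ᵍ v          ≡⟨ cong (λ w → (v +ᵍ w) *ᵍ v) u-v≡2h ⟨
    (v +ᵍ (u -ᵍ v)) *ᵍ v         ≡⟨ solve (u ∷ v ∷ []) ℤ[i]-ring ⟩
    u *ᵍ v                       ∎
  [x-A]²+[y-B]²≡[u-c][v-c′] :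
    (x -ᵍ A) *ᵍ (x -ᵍ A) +ᵍ (y -ᵍ B) *ᵍ (y -ᵍ B) ≡ (u -ᵍ (A +ᵍ iᵍ *ᵍ B)) *ᵍ (v -ᵍ (A -ᵍ iᵍ *ᵍ B))
  [x-A]²+[y-B]²≡[u-c][v-c′] = begin
    ((1ᵍ *ᵍ h +ᵍ 1ᵍ *ᵍ v) -ᵍ A) *ᵍ ((1ᵍ *ᵍ h +ᵍ 1ᵍ *ᵍ v) -ᵍ A)
      +ᵍ (((-ᵍ iᵍ) *ᵍ h +ᵍ 0ᵍ *ᵍ v) -ᵍ B) *ᵍ (((-ᵍ iᵍ) *ᵍ h +ᵍ 0ᵍ *ᵍ v) -ᵍ B)
      ≡⟨ solve (h ∷ v ∷ A ∷ B ∷ []) ℤ[i]-ring ⟩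
    ((v +ᵍ 2ᵍ *ᵍ h) -ᵍ (A +ᵍ iᵍ *ᵍ B)) *ᵍ (v -ᵍ (A -ᵍ iᵍ *ᵍ B))
      ≡⟨ cong (λ w → ((v +ᵍ w) -ᵍ (A +ᵍ iᵍ *ᵍ B)) *ᵍ (v -ᵍ (A -ᵍ iᵍ *ᵍ B))) u-v≡2h ⟨
    ((v +ᵍ (u -ᵍ v)) -ᵍ (A +ᵍ iᵍ *ᵍ B)) *ᵍ (v -ᵍ (A -ᵍ iᵍ *ᵍ B))
      ≡⟨ solve (u ∷ v ∷ A ∷ B ∷ []) ℤ[i]-ring ⟩
    (u -ᵍ (A +ᵍ iᵍ *ᵍ B)) *ᵍ (v -ᵍ (A -ᵍ iᵍ *ᵍ B)) ∎

S₂-dense : ∀ {A B} → A +ᵍ iᵍ *ᵍ B ≢ 0ᵍ → A -ᵍ iᵍ *ᵍ B ≢ 0ᵍ →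
  Parameters (A +ᵍ iᵍ *ᵍ B) (A -ᵍ iᵍ *ᵍ B) → ZariskiDense (S₂ A B)
S₂-dense {A} {B} c≢0 c′≢0 P =
  ZariskiDense-substitute {S₂ A B} ℓˣ ℓʸ ℓˣℓʸ-surjective
    (ZariskiDense-criterion
      (Unbounded-map (λ {v} → Unbounded-map (λ {h} (u , u-v≡2h , admissible) →
                                  S₂-light-cone A B u v h u-v≡2h admissible))
        (PellConstruction.admissible-unbounded c≢0 c′≢0 σ+σ≡c′m 8≤‖m‖ parity)))
  where open Parameters P

3ᵍ 6ᵍ : ℤ[i]
3ᵍ = ι (+ 3)
6ᵍ = ι (+ 6)

Odd-3 : Odd 3ᵍ
Odd-3 = 1-i , refl

-- Any m with ‖m‖ ≥ 8 would do, but σ = c′m/2 has to be odd unless c is even.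
parameters : ∀ {c c′} → 2ᵍ ∣ᵍ c ⊎ Odd c′ ⊎ (∃ λ o → Odd o × c′ ≡ 1-i *ᵍ o) → Parameters c c′
parameters {c′ = c′} (inj₁ 2∣c) = record
  { σ = 3ᵍ *ᵍ c′ ; m = 6ᵍ ; σ+σ≡c′m = solve (c′ ∷ []) ℤ[i]-ring ; 8≤‖m‖ = ≤ᵇ⇒≤ 8 36 _
  ; parity = inj₁ 2∣c }
parameters {c′ = c′} (inj₂ (inj₁ odd-c′)) = record
  { σ = 3ᵍ *ᵍ c′ ; m = 6ᵍ ; σ+σ≡c′m = solve (c′ ∷ []) ℤ[i]-ring ; 8≤‖m‖ = ≤ᵇ⇒≤ 8 36 _
  ; parity = inj₂ (Odd-* Odd-3 odd-c′ , 3ᵍ *ᵍ 1-i , refl) }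
parameters (inj₂ (inj₂ (o , odd-o , refl))) = record
  { σ = 3ᵍ *ᵍ o ; m = 3ᵍ *ᵍ 1+i ; σ+σ≡c′m = solve (o ∷ []) ℤ[i]-ring ; 8≤‖m‖ = ≤ᵇ⇒≤ 8 18 _
  ; parity = inj₂ (Odd-* Odd-3 odd-o , 3ᵍ , refl) }

EvenOrOdd : ℤ[i] → Set
EvenOrOdd z = ∃ λ x → z ≡ x +ᵍ x ⊎ z ≡ 1ᵍ +ᵍ (x +ᵍ x)

ι-EvenOrOdd : ∀ a → EvenOrOdd (ι a)
ι-EvenOrOdd a with a ℤ./ℕ 2 | a ℤ.%ℕ 2 | a≡a%ℕn+[a/ℕn]*n a 2 | n%ℕd<d a 2
... | q | 0           | a≡0+2q | _ = ι q , inj₁ (ℤ[i]-ext (trans a≡0+2q (0+2q≡q+q q)) refl)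
  where
  0+2q≡q+q : ∀ q → + 0 ℤ.+ q ℤ.* + 2 ≡ q ℤ.+ q
  0+2q≡q+q = ℤSolver.solve-∀
... | q | 1           | a≡1+2q | _ = ι q , inj₂ (ℤ[i]-ext (trans a≡1+2q (1+2q≡1+[q+q] q)) refl)
  where
  1+2q≡1+[q+q] : ∀ q → + 1 ℤ.+ q ℤ.* + 2 ≡ + 1 ℤ.+ (q ℤ.+ q)
  1+2q≡1+[q+q] = ℤSolver.solve-∀
... | _ | suc (suc _) | _      | s≤s (s≤s ())

parity-cases : ∀ {A B} → EvenOrOdd A → EvenOrOdd B →
  2ᵍ ∣ᵍ A +ᵍ iᵍ *ᵍ B ⊎ Odd (A -ᵍ iᵍ *ᵍ B) ⊎ (∃ λ o → Odd o × A -ᵍ iᵍ *ᵍ B ≡ 1-i *ᵍ o)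
parity-cases (x , inj₁ refl) (y , inj₁ refl) =
  inj₁ (x +ᵍ iᵍ *ᵍ y , solve (x ∷ y ∷ []) ℤ[i]-ring)
parity-cases (x , inj₂ refl) (y , inj₁ refl) =
  inj₂ (inj₁ (1-i *ᵍ (x -ᵍ iᵍ *ᵍ y) , solve (x ∷ y ∷ []) ℤ[i]-ring))
parity-cases (x , inj₁ refl) (y , inj₂ refl) =
  inj₂ (inj₁ (1-i *ᵍ (x -ᵍ iᵍ *ᵍ y) -ᵍ 1ᵍ , solve (x ∷ y ∷ []) ℤ[i]-ring))
parity-cases (x , inj₂ refl) (y , inj₂ refl) =
  inj₂ (inj₂ (1ᵍ +ᵍ 1+i *ᵍ (x -ᵍ iᵍ *ᵍ y) , (x -ᵍ iᵍ *ᵍ y , refl) , solve (x ∷ y ∷ []) ℤ[i]-ring))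

ι-a+ib≢0 : ∀ {a b} → ¬ (a ≡ + 0 × b ≡ + 0) → ι a +ᵍ iᵍ *ᵍ ι b ≢ 0ᵍ
ι-a+ib≢0 {+[1+ _ ]}          _    ()
ι-a+ib≢0 { -[1+ _ ]}         _    ()
ι-a+ib≢0 {+0} {+[1+ _ ]}     _    ()
ι-a+ib≢0 {+0} { -[1+ _ ]}    _    ()
ι-a+ib≢0 {+0} {+0}           ab≢0 _ = ab≢0 (refl , refl)

ι-a-ib≢0 : ∀ {a b} → ¬ (a ≡ + 0 × b ≡ + 0) → ι a -ᵍ iᵍ *ᵍ ι b ≢ 0ᵍ
ι-a-ib≢0 {+[1+ _ ]}          _    ()
ι-a-ib≢0 { -[1+ _ ]}         _    ()
ι-a-ib≢0 {+0} {+[1+ _ ]}     _    ()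
ι-a-ib≢0 {+0} { -[1+ _ ]}    _    ()
ι-a-ib≢0 {+0} {+0}           ab≢0 _ = ab≢0 (refl , refl)

proposition8p2 : (a b : ℤ) → ¬ ((a ≡ + 0) × (b ≡ + 0)) →
    ZariskiDense (InS₂ a b)
proposition8p2 a b ab≢0 =
  S₂-dense {ι a} {ι b} (ι-a+ib≢0 ab≢0) (ι-a-ib≢0 ab≢0)
    (parameters (parity-cases (ι-EvenOrOdd a) (ι-EvenOrOdd b)))
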